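{- Let $n$ be a multiple of $32$. If $\pi$ is sampled uniformly at random from all permutations of $[n]$, then with probability at least $1 - 2^{ -\Omega(n)}$, $\pi$ is a type 1 order with parameter $n/32$.
   Context: A permutation $\pi = \pi_1\cdots\pi_n$ of $[n]$ is a type 1 order with parameter $m$ if there are index sets $I = \{i_1,\dots,i_m\}$ and $J = \{j_1,\dots,j_m\}$ with $|I|=|J|=m$, $\max(I) < \min(J)$, and $1 \le \pi_{i_1} < \pi_{j_1} < \pi_{i_2} < \pi_{j_2} < \cdots < \pi_{i_m} < \pi_{j_m} < n$. -}

module Defs where

open import Data.Nat using (ℕ; zero; suc; _<_; _≤_; _∸_; _+_)
open import Data.Fin using (Fin; toℕ)
open import Data.Vec using (Vec; lookup; toList)
open import Data.List using (List; map; upTo)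
open import Data.List.Relation.Binary.Permutation.Propositional using (_↭_)
open import Data.Product using (Σ; _×_)

-- A permutation of [n] = {1,…,n} in one-line notation π = π₁⋯πₙ,
-- stored 0-indexed by position: lookup π p is π_{p+1}.
-- It is a permutation iff its entries are a rearrangement of 1,…,n.
IsPerm : ∀ {n} → Vec ℕ n → Set
IsPerm {n} π = toList π ↭ map suc (upTo n)

-- The index sets I = {i_1,…,i_m},
-- J = {j_1,…,j_m} are given by labelings i, j : ℕ → Fin n (used on
-- 0 … m-1, i.e. i a is the position i_{a+1}).  The labeling is the one
-- appearing in the value chain (not necessarily sorted by position);
-- |I| = |J| = m follows since the chain values are strictly increasing.
Type1 : ∀ {n} → Vec ℕ n → ℕ → Set
Type1 {n} π m =
  Σ (ℕ → Fin n) λ i → Σ (ℕ → Fin n) λ j →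
      (∀ a b → a < m → b < m → toℕ (i a) < toℕ (j b))
    ×
      (∀ a → a < m → lookup π (i a) < lookup π (j a))
    ×
      (∀ a → suc a < m → lookup π (j a) < lookup π (i (suc a)))
    ×
      (0 < m → (1 ≤ lookup π (i 0)) × (lookup π (j (m ∸ 1)) < n))

-- Split π into halves xs and ys of h = n/2 = 16k entries (k = n/32) and group the values into
-- the pairs {2t+1, 2t+2}.  Call a pair good if its smaller value lies in xs and its larger one in
-- ys.  Any k+1 good pairs e₀ < ⋯ < e_k make π a type 1 order with parameter k: take i_a and j_a
-- to be the positions of e_a and e_a + 1.  The values in xs are recorded by a 0/1 word of
-- length 2h, and given the word, xs and ys are arrangements of its ones and of its zeros.  So at
-- most (number of words with ≤ k good pairs)·(h!)² ≤ 13^h 4^(k-h) (h!)² permutations fail, and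
-- 4^h (h!)² ≤ (2h+1)(2h)! together with 2h+1 ≤ 2^k (k ≥ 9) turns this into (2h)!·2^(-k).

module Submission where

open import Data.Bool using (Bool; true; false; not)
open import Data.Fin using (Fin; toℕ)
open import Data.Nat
open import Data.Nat.Properties
open import Data.Nat.Divisibility using (_∣_; divides)
open import Data.Nat.DivMod using (m*n/n≡m)
open import Data.Nat.Tactic.RingSolver using (solve-∀)
open import Data.List using (List; []; _∷_; _++_; [_]; map; length; concatMap; cartesianProductWith; filter)
open import Data.List.Properties using (length-++; length-map; filter-notAll)
open import Data.List.Membership.Propositional using (_∈_; _∉_; lose)
open import Data.List.Membership.Propositional.Properties using (∈-++⁺ˡ; ∈-++⁺ʳ; ∈-map⁺; ∈-map⁻; ∈-upTo⁺; ∈-upTo⁻; ∈-concatMap⁺; ∈-filter⁺; ∈-cartesianProductWith⁺)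
open import Data.List.Relation.Binary.Permutation.Propositional using (↭-sym; ↭⇒↭ₛ)
open import Data.List.Relation.Binary.Permutation.Propositional.Properties using (Any-resp-↭)
open import Relation.Binary.PropositionalEquality as ≡ using (_≡_; _≢_; refl; sym; trans; cong; cong₂; subst; subst₂; module ≡-Reasoning)
open import Data.List.Relation.Binary.Permutation.Setoid.Properties (≡.setoid ℕ) using (Unique-resp-↭)
open import Data.List.Relation.Unary.All as All using (All; []; _∷_)
open import Data.List.Relation.Unary.All.Properties as All using ()
open import Data.List.Relation.Unary.AllPairs using (AllPairs; []; _∷_)
open import Data.List.Relation.Unary.Any as Any using (here; there)
open import Data.List.Relation.Unary.Unique.Propositional using (Unique)
open import Data.List.Relation.Unary.Unique.Propositional.Properties as Unique using (upTo⁺)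
open import Data.Product using (Σ; _×_; _,_; proj₁; proj₂; map₂; uncurry)
open import Data.Sum using (inj₁; inj₂; [_,_]′)
open import Data.Vec using (Vec; []; _∷_; lookup; toList; splitAt) renaming (_++_ to _++ᵥ_)
open import Data.Vec.Membership.DecPropositional _≟_ using (_∈?_)
open import Data.Vec.Membership.Propositional using () renaming (_∈_ to _∈ᵥ_; _∉_ to _∉ᵥ_)
open import Data.Vec.Membership.Propositional.Properties using (∈-toList⁺; ∈-toList⁻) renaming (∈-++⁺ˡ to ∈ᵥ-++⁺ˡ; ∈-++⁺ʳ to ∈ᵥ-++⁺ʳ)
open import Data.Vec.Properties using (toList-++)
open import Data.Vec.Relation.Unary.Any using (index; here; there)
open import Data.Vec.Relation.Unary.Any.Properties as Anyᵥ using (lookup-index)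
open import Function using (_∘_; id)
open import Level using (Level)
open import Relation.Binary.Definitions using (DecidableEquality; tri<; tri≈; tri>)
open import Relation.Nullary using (¬_; ¬?; does; yes; no; contradiction)
open import Relation.Unary using (Pred; Decidable)
open import Defs

module _ {A B : Set} where

  length-concatMap-≤ : ∀ (f : A → List B) xs {c} → (∀ {x} → x ∈ xs → length (f x) ≤ c) →
                       length (concatMap f xs) ≤ length xs * c
  length-concatMap-≤ f []       bound = z≤n
  length-concatMap-≤ f (x ∷ xs) {c} bound = begin
    length (f x ++ concatMap f xs)         ≡⟨ length-++ (f x) ⟩
    length (f x) + length (concatMap f xs) ≤⟨ +-mono-≤ (bound (here refl)) (length-concatMap-≤ f xs (bound ∘ there)) ⟩
    c + length xs * c                      ∎
    where open ≤-Reasoning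

  ∈-concatMap⁺′ : ∀ (f : A → List B) {xs x y} → x ∈ xs → y ∈ f x → y ∈ concatMap f xs
  ∈-concatMap⁺′ f x∈xs y∈fx = ∈-concatMap⁺ f (lose x∈xs y∈fx)

Unique-++⁻ : ∀ {A : Set} (xs : List A) {ys} → Unique (xs ++ ys) →
             Unique xs × Unique ys × (∀ {y} → y ∈ ys → y ∉ xs)
Unique-++⁻ []       ys!           = [] , ys! , λ _ ()
Unique-++⁻ (x ∷ xs) (x∉ ∷ xsys!) with Unique-++⁻ xs xsys!
... | xs! , ys! , disjoint = All.++⁻ˡ xs x∉ ∷ xs! , ys! , λ where
  y∈ys (here refl)   → All.lookup (All.++⁻ʳ xs x∉) y∈ys refl
  y∈ys (there y∈xs) → disjoint y∈ys y∈xs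

length-cartesianProductWith : ∀ {A B C : Set} (f : A → B → C) xs ys →
                              length (cartesianProductWith f xs ys) ≡ length xs * length ys
length-cartesianProductWith f []       ys = refl
length-cartesianProductWith f (x ∷ xs) ys = begin
    length (map (f x) ys ++ cartesianProductWith f xs ys)
  ≡⟨ length-++ (map (f x) ys) ⟩
    length (map (f x) ys) + length (cartesianProductWith f xs ys)
  ≡⟨ cong₂ _+_ (length-map (f x) ys) (length-cartesianProductWith f xs ys) ⟩
    length ys + length xs * length ys
  ∎
  where open ≡-Reasoning

module Arrangements {A : Set} (_≟_ : DecidableEquality A) where

  remove : A → List A → List A
  remove x = filter (λ y → ¬? (y ≟ x))

  length-remove-< : ∀ {x xs} → x ∈ xs → length (remove x xs) < length xs
  length-remove-< {x} x∈xs = filter-notAll (λ y → ¬? (y ≟ x)) _ (Any.map (λ { refl y≢x → y≢x refl }) x∈xs)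

  arrangements : List A → (r : ℕ) → List (Vec A r)
  arrangementsStartingWith : List A → (r : ℕ) → A → List (Vec A (suc r))

  arrangements S zero    = [ [] ]
  arrangements S (suc r) = concatMap (arrangementsStartingWith S r) S

  arrangementsStartingWith S r x = map (x ∷_) (arrangements (remove x S) r)

  ∈-arrangements : ∀ S {r} (xs : Vec A r) → Unique (toList xs) → All (_∈ S) (toList xs) → xs ∈ arrangements S r
  ∈-arrangements S []       _            _            = here refl
  ∈-arrangements S (x ∷ xs) (x∉xs ∷ xs!) (x∈S ∷ xs⊆S) =
    ∈-concatMap⁺′ (arrangementsStartingWith S _) x∈S
      (∈-map⁺ (x ∷_) (∈-arrangements (remove x S) xs xs! (All.zipWith (uncurry keep) (x∉xs , xs⊆S))))
    where
    keep : ∀ {y} → x ≢ y → y ∈ S → y ∈ remove x S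
    keep x≢y y∈S = ∈-filter⁺ (λ y → ¬? (y ≟ x)) y∈S (λ y≡x → x≢y (sym y≡x))

  length-arrangements-≤ : ∀ S r → length S ≤ r → length (arrangements S r) ≤ r !
  length-arrangements-≤ S zero    _  = ≤-refl
  length-arrangements-≤ S (suc r) |S|≤1+r = begin
    length (arrangements S (suc r)) ≤⟨ length-concatMap-≤ (arrangementsStartingWith S r) S per-head ⟩
    length S * r !                  ≤⟨ *-monoˡ-≤ (r !) |S|≤1+r ⟩
    suc r !                         ∎
    where
    open ≤-Reasoning
    per-head : ∀ {x} → x ∈ S → length (arrangementsStartingWith S r x) ≤ r !
    per-head {x} x∈S = ≤-trans (≤-reflexive (length-map (x ∷_) (arrangements (remove x S) r)))
      (length-arrangements-≤ (remove x S) r (≤-pred (≤-trans (length-remove-< x∈S) |S|≤1+r)))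

  length-arrangements-< : ∀ S r → length S < r → length (arrangements S r) ≡ 0
  length-arrangements-< S (suc r) |S|<1+r = n≤0⇒n≡0 (begin
    length (arrangements S (suc r)) ≤⟨ length-concatMap-≤ (arrangementsStartingWith S r) S per-head ⟩
    length S * 0                    ≡⟨ *-zeroʳ (length S) ⟩
    0                               ∎)
    where
    open ≤-Reasoning
    per-head : ∀ {x} → x ∈ S → length (arrangementsStartingWith S r x) ≤ 0
    per-head {x} x∈S = ≤-reflexive (trans (length-map (x ∷_) (arrangements (remove x S) r))
      (length-arrangements-< (remove x S) r (<-≤-trans (length-remove-< x∈S) (≤-pred |S|<1+r))))

  length-arrangements-pair : ∀ S T r → length S + length T ≡ r + r →
                             length (arrangements S r) * length (arrangements T r) ≤ r ! * r !
  length-arrangements-pair S T r |S|+|T|≡ with <-cmp (length S) r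
  ... | tri< |S|<r _ _ =
    ≤-trans (≤-reflexive (cong (_* length (arrangements T r)) (length-arrangements-< S r |S|<r))) z≤n
  ... | tri≈ _ |S|≡r _ =
    *-mono-≤ (length-arrangements-≤ S r (≤-reflexive |S|≡r)) (length-arrangements-≤ T r (≤-reflexive |T|≡r))
    where
    |T|≡r : length T ≡ r
    |T|≡r = +-cancelˡ-≡ r (length T) r (trans (cong (_+ length T) (sym |S|≡r)) |S|+|T|≡)
  ... | tri> _ _ r<|S| =
    ≤-trans (≤-reflexive (trans (cong (length (arrangements S r) *_) (length-arrangements-< T r |T|<r))
                                (*-zeroʳ (length (arrangements S r)))))
            z≤n
    where
    |T|<r : length T < r
    |T|<r = +-cancelˡ-< r (length T) r (subst (r + length T <_) |S|+|T|≡ (+-monoˡ-< (length T) r<|S|))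

-- Words and good pairs

select : ℕ → List Bool → List ℕ
select v []           = []
select v (true ∷ bs)  = v ∷ select (suc v) bs
select v (false ∷ bs) = select (suc v) bs

length-select-complement : ∀ v bs → length (select v bs) + length (select v (map not bs)) ≡ length bs
length-select-complement v []           = refl
length-select-complement v (true ∷ bs)  = cong suc (length-select-complement (suc v) bs)
length-select-complement v (false ∷ bs) =
  trans (+-suc (length (select (suc v) bs)) _) (cong suc (length-select-complement (suc v) bs))

∈-select-∷ : ∀ {u v} b bs → u ∈ select (suc v) bs → u ∈ select v (b ∷ bs)
∈-select-∷ true  bs u∈ = there u∈
∈-select-∷ false bs u∈ = u∈

module _ {ℓ : Level} {P : Pred ℕ ℓ} (P? : Decidable P) where

  indicator : ℕ → ℕ → List Bool
  indicator v zero    = []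
  indicator v (suc m) = does (P? v) ∷ indicator (suc v) m

  length-indicator : ∀ v m → length (indicator v m) ≡ m
  length-indicator v zero    = refl
  length-indicator v (suc m) = cong suc (length-indicator (suc v) m)

  ∈-select-indicator⁺ : ∀ {u v m} → P u → v ≤ u → u < v + m → u ∈ select v (indicator v m)
  ∈-select-indicator⁺ {u} {v} {zero}  _  v≤u u<v+0 = contradiction (subst (u <_) (+-identityʳ v) u<v+0) (≤⇒≯ v≤u)
  ∈-select-indicator⁺ {u} {v} {suc m} pu v≤u u<v+1+m with P? v | m≤n⇒m<n∨m≡n v≤u
  ... | yes _  | inj₂ refl = here refl
  ... | no ¬pv | inj₂ refl = contradiction pu ¬pv
  ... | yes _  | inj₁ v<u  = there (∈-select-indicator⁺ pu v<u (subst (u <_) (+-suc v m) u<v+1+m))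
  ... | no _   | inj₁ v<u  = ∈-select-indicator⁺ pu v<u (subst (u <_) (+-suc v m) u<v+1+m)

  ∈-select-indicator⁻ : ∀ {u v m} → u ∈ select v (indicator v m) → P u × u < v + m
  ∈-select-indicator⁻ {u} {v} {suc m} u∈ with P? v | u∈
  ... | yes pv | here refl = pv , m<m+n v z<s
  ... | yes _  | there u∈′ = map₂ (subst (u <_) (sym (+-suc v m))) (∈-select-indicator⁻ {u} {suc v} {m} u∈′)
  ... | no _   | u∈′       = map₂ (subst (u <_) (sym (+-suc v m))) (∈-select-indicator⁻ {u} {suc v} {m} u∈′)

map-not-indicator : ∀ {ℓ} {P : Pred ℕ ℓ} (P? : Decidable P) v m →
                    map not (indicator P? v m) ≡ indicator (¬? ∘ P?) v m
map-not-indicator P? v zero    = refl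
map-not-indicator P? v (suc m) = cong (_ ∷_) (map-not-indicator P? (suc v) m)

goodValues : ℕ → List Bool → List ℕ
goodValues v []                  = []
goodValues v (_ ∷ [])            = []
goodValues v (true ∷ false ∷ bs) = v ∷ goodValues (2 + v) bs
goodValues v (true ∷ true ∷ bs)  = goodValues (2 + v) bs
goodValues v (false ∷ _ ∷ bs)    = goodValues (2 + v) bs

goodValues-lower : ∀ v bs → All (v ≤_) (goodValues v bs)
goodValues-lower v []                  = []
goodValues-lower v (_ ∷ [])            = []
goodValues-lower v (true ∷ false ∷ bs) = ≤-refl ∷ All.map (≤-trans (m≤n+m v 2)) (goodValues-lower (2 + v) bs)
goodValues-lower v (true ∷ true ∷ bs)  = All.map (≤-trans (m≤n+m v 2)) (goodValues-lower (2 + v) bs)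
goodValues-lower v (false ∷ _ ∷ bs)    = All.map (≤-trans (m≤n+m v 2)) (goodValues-lower (2 + v) bs)

goodValues-gaps : ∀ v bs → AllPairs (λ e e′ → suc e < e′) (goodValues v bs)
goodValues-gaps v []                  = []
goodValues-gaps v (_ ∷ [])            = []
goodValues-gaps v (true ∷ false ∷ bs) = goodValues-lower (2 + v) bs ∷ goodValues-gaps (2 + v) bs
goodValues-gaps v (true ∷ true ∷ bs)  = goodValues-gaps (2 + v) bs
goodValues-gaps v (false ∷ _ ∷ bs)    = goodValues-gaps (2 + v) bs

GoodValue : ℕ → List Bool → ℕ → Set
GoodValue v bs e = e ∈ select v bs × suc e ∈ select v (map not bs)

GoodValue-∷∷ : ∀ a b {v bs e} → GoodValue (2 + v) bs e → GoodValue v (a ∷ b ∷ bs) e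
GoodValue-∷∷ a b {bs = bs} (e∈ , 1+e∈) =
  ∈-select-∷ a _ (∈-select-∷ b bs e∈) , ∈-select-∷ (not a) _ (∈-select-∷ (not b) (map not bs) 1+e∈)

goodValues-good : ∀ v bs → All (GoodValue v bs) (goodValues v bs)
goodValues-good v []                  = []
goodValues-good v (_ ∷ [])            = []
goodValues-good v (true ∷ false ∷ bs) =
  (here refl , here refl) ∷ All.map (GoodValue-∷∷ true false {bs = bs}) (goodValues-good (2 + v) bs)
goodValues-good v (true ∷ true ∷ bs)  = All.map (GoodValue-∷∷ true true {bs = bs}) (goodValues-good (2 + v) bs)
goodValues-good v (false ∷ b ∷ bs)    = All.map (GoodValue-∷∷ false b {bs = bs}) (goodValues-good (2 + v) bs)

neutralPairs : List (List Bool)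
neutralPairs = (true ∷ true ∷ []) ∷ (false ∷ true ∷ []) ∷ (false ∷ false ∷ []) ∷ []

sparseWords : ℕ → ℕ → List (List Bool)
sparseWords zero    j       = [ [] ]
sparseWords (suc r) zero    = cartesianProductWith _++_ neutralPairs (sparseWords r zero)
sparseWords (suc r) (suc j) = cartesianProductWith _++_ neutralPairs (sparseWords r (suc j))
                           ++ map (λ bs → true ∷ false ∷ bs) (sparseWords r j)

∈-sparseWords-neutral : ∀ r j {p bs} → p ∈ neutralPairs → bs ∈ sparseWords r j → p ++ bs ∈ sparseWords (suc r) j
∈-sparseWords-neutral r zero    p∈ bs∈ = ∈-cartesianProductWith⁺ _++_ p∈ bs∈
∈-sparseWords-neutral r (suc j) p∈ bs∈ = ∈-++⁺ˡ (∈-cartesianProductWith⁺ _++_ p∈ bs∈)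

∈-sparseWords : ∀ r j v bs → length bs ≡ r + r → length (goodValues v bs) ≤ j → bs ∈ sparseWords r j
∈-sparseWords zero    j v []       _      _ = here refl
∈-sparseWords (suc r) j v (_ ∷ []) |bs|≡ _ = contradiction (trans (suc-injective |bs|≡) (+-suc r r)) λ ()
∈-sparseWords (suc r) j v (a ∷ b ∷ bs) |bs|≡ count = extend a b j count
  where
  |tail|≡ : length bs ≡ r + r
  |tail|≡ = suc-injective (trans (suc-injective |bs|≡) (+-suc r r))
  tail∈ : ∀ j → length (goodValues (2 + v) bs) ≤ j → bs ∈ sparseWords r j
  tail∈ j = ∈-sparseWords r j (2 + v) bs |tail|≡
  extend : ∀ a b j → length (goodValues v (a ∷ b ∷ bs)) ≤ j → a ∷ b ∷ bs ∈ sparseWords (suc r) j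
  extend true  false (suc j) (s≤s count) = ∈-++⁺ʳ _ (∈-map⁺ _ (tail∈ j count))
  extend true  true  j       count       = ∈-sparseWords-neutral r j (here refl) (tail∈ j count)
  extend false true  j       count       = ∈-sparseWords-neutral r j (there (here refl)) (tail∈ j count)
  extend false false j       count       = ∈-sparseWords-neutral r j (there (there (here refl))) (tail∈ j count)

neutral-extension-length : ∀ {r W} → All (λ bs → length bs ≡ r + r) W →
                           All (λ bs → length bs ≡ suc r + suc r) (cartesianProductWith _++_ neutralPairs W)
neutral-extension-length {r} {W} W-length =
  All.cartesianProductWith⁺ (≡.setoid _) (≡.setoid _) _++_ neutralPairs W λ {p} {bs} p∈ bs∈ → begin
    length (p ++ bs)     ≡⟨ length-++ p ⟩
    length p + length bs ≡⟨ cong₂ _+_ (All.lookup pair-length p∈) (All.lookup W-length bs∈) ⟩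
    2 + (r + r)          ≡⟨ cong suc (sym (+-suc r r)) ⟩
    suc r + suc r        ∎
  where
  open ≡-Reasoning
  pair-length : All (λ p → length p ≡ 2) neutralPairs
  pair-length = refl ∷ refl ∷ refl ∷ []

sparseWords-length : ∀ r j → All (λ bs → length bs ≡ r + r) (sparseWords r j)
sparseWords-length zero    j       = refl ∷ []
sparseWords-length (suc r) zero    = neutral-extension-length (sparseWords-length r zero)
sparseWords-length (suc r) (suc j) = All.++⁺ (neutral-extension-length (sparseWords-length r (suc j)))
  (All.map⁺ (All.map (λ |bs|≡ → trans (cong (2 +_) |bs|≡) (cong suc (sym (+-suc r r)))) (sparseWords-length r j)))

-- The words are counted by Σ_{i ≤ j} C(r,i) 3^(r-i), which is at most 4^j (3 + 1/4)^r.
length-sparseWords : ∀ r j → length (sparseWords r j) * 4 ^ r ≤ 13 ^ r * 4 ^ j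
length-sparseWords zero    j       = ≤-trans (m^n>0 4 j) (m≤m+n (4 ^ j) 0)
length-sparseWords (suc r) zero    = begin
    length (sparseWords (suc r) 0) * (4 * 4 ^ r)
  ≡⟨ cong (_* (4 * 4 ^ r)) (length-cartesianProductWith _++_ neutralPairs (sparseWords r 0)) ⟩
    3 * s * (4 * 4 ^ r)
  ≡⟨ regroup s (4 ^ r) ⟩
    12 * (s * 4 ^ r)
  ≤⟨ *-monoʳ-≤ 12 (length-sparseWords r 0) ⟩
    12 * (13 ^ r * 1)
  ≤⟨ *-monoˡ-≤ (13 ^ r * 1) (n≤1+n 12) ⟩
    13 * (13 ^ r * 1)
  ≡⟨ *-assoc 13 (13 ^ r) 1 ⟨
    13 ^ suc r * 4 ^ 0
  ∎
  where
  open ≤-Reasoning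
  s : ℕ
  s = length (sparseWords r 0)
  regroup : ∀ s x → 3 * s * (4 * x) ≡ 12 * (s * x)
  regroup = solve-∀
length-sparseWords (suc r) (suc j) = begin
    length (sparseWords (suc r) (suc j)) * (4 * 4 ^ r)
  ≡⟨ cong (_* (4 * 4 ^ r)) recurrence ⟩
    (3 * s + s′) * (4 * 4 ^ r)
  ≡⟨ regroup s s′ (4 ^ r) ⟩
    12 * (s * 4 ^ r) + 4 * (s′ * 4 ^ r)
  ≤⟨ +-mono-≤ (*-monoʳ-≤ 12 (length-sparseWords r (suc j))) (*-monoʳ-≤ 4 (length-sparseWords r j)) ⟩
    12 * (13 ^ r * (4 * 4 ^ j)) + 4 * (13 ^ r * 4 ^ j)
  ≡⟨ collect (13 ^ r) (4 ^ j) ⟩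
    13 ^ suc r * 4 ^ suc j
  ∎
  where
  open ≤-Reasoning
  s s′ : ℕ
  s = length (sparseWords r (suc j))
  s′ = length (sparseWords r j)
  recurrence : length (sparseWords (suc r) (suc j)) ≡ 3 * s + s′
  recurrence = trans (length-++ (cartesianProductWith _++_ neutralPairs (sparseWords r (suc j))))
    (cong₂ _+_ (length-cartesianProductWith _++_ neutralPairs (sparseWords r (suc j))) (length-map _ (sparseWords r j)))
  regroup : ∀ s s′ x → (3 * s + s′) * (4 * x) ≡ 12 * (s * x) + 4 * (s′ * x)
  regroup = solve-∀
  collect : ∀ y z → 12 * (y * (4 * z)) + 4 * (y * z) ≡ 13 * y * (4 * z)
  collect = solve-∀

-- Type 1 orders from chains of good pairs

nth : List ℕ → ℕ → ℕ
nth []       _       = 0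
nth (x ∷ _)  zero    = x
nth (_ ∷ xs) (suc a) = nth xs a

All-nth : ∀ {P : ℕ → Set} {xs} → All P xs → ∀ {a} → a < length xs → P (nth xs a)
All-nth (px ∷ _)   {zero}  _         = px
All-nth (_  ∷ pxs) {suc a} (s≤s a<) = All-nth pxs a<

AllPairs-nth-suc : ∀ {R : ℕ → ℕ → Set} {xs} → AllPairs R xs →
                   ∀ {a} → suc a < length xs → R (nth xs a) (nth xs (suc a))
AllPairs-nth-suc ((Rxy ∷ _) ∷ _) {zero}  _         = Rxy
AllPairs-nth-suc (_ ∷ Rxs)       {suc a} (s≤s a<) = AllPairs-nth-suc Rxs a<

module _ {A : Set} where

  toℕ-index-∈ᵥ-++⁺ˡ : ∀ {m n x} {xs : Vec A m} {ys : Vec A n} (x∈xs : x ∈ᵥ xs) →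
                      toℕ (index (∈ᵥ-++⁺ˡ {ys = ys} x∈xs)) < m
  toℕ-index-∈ᵥ-++⁺ˡ (here refl) = z<s
  toℕ-index-∈ᵥ-++⁺ˡ (there x∈) = s<s (toℕ-index-∈ᵥ-++⁺ˡ x∈)

  toℕ-index-∈ᵥ-++⁺ʳ : ∀ {m n x} (xs : Vec A m) {ys : Vec A n} (x∈ys : x ∈ᵥ ys) →
                      m ≤ toℕ (index (∈ᵥ-++⁺ʳ xs x∈ys))
  toℕ-index-∈ᵥ-++⁺ʳ []       _    = z≤n
  toℕ-index-∈ᵥ-++⁺ʳ (_ ∷ xs) x∈ys = s≤s (toℕ-index-∈ᵥ-++⁺ʳ xs x∈ys)

type1-from-chain : ∀ {h k} (xs ys : Vec ℕ h) (g : List ℕ) →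
                   (∀ {x} → x ∈ᵥ xs ++ᵥ ys → 1 ≤ x × x ≤ h + h) →
                   All (λ e → e ∈ᵥ xs × suc e ∈ᵥ ys) g → AllPairs (λ e e′ → suc e < e′) g → k < length g →
                   Type1 (xs ++ᵥ ys) k
type1-from-chain {h} {k} xs ys g range halves gaps k<|g| = i , j , i<j , e<1+e , 1+e<e′ , ends
  where
  -- Clamping at k keeps every index inside g, so e, i and j are total; Type1 only looks at a < k.
  e : ℕ → ℕ
  e a = nth g (a ⊓ k)
  e∈halves : ∀ a → e a ∈ᵥ xs × suc (e a) ∈ᵥ ys
  e∈halves a = All-nth halves (≤-<-trans (m⊓n≤n a k) k<|g|)
  i j : ℕ → Fin (h + h)
  i a = index (∈ᵥ-++⁺ˡ (proj₁ (e∈halves a)))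
  j a = index (∈ᵥ-++⁺ʳ xs (proj₂ (e∈halves a)))
  π[i] : ∀ a → lookup (xs ++ᵥ ys) (i a) ≡ e a
  π[i] a = sym (lookup-index (∈ᵥ-++⁺ˡ (proj₁ (e∈halves a))))
  π[j] : ∀ a → lookup (xs ++ᵥ ys) (j a) ≡ suc (e a)
  π[j] a = sym (lookup-index (∈ᵥ-++⁺ʳ xs (proj₂ (e∈halves a))))
  e≡nth : ∀ {a} → a < k → e a ≡ nth g a
  e≡nth a<k = cong (nth g) (m≤n⇒m⊓n≡m (<⇒≤ a<k))
  i<j : ∀ a b → a < k → b < k → toℕ (i a) < toℕ (j b)
  i<j a b _ _ = <-≤-trans (toℕ-index-∈ᵥ-++⁺ˡ (proj₁ (e∈halves a))) (toℕ-index-∈ᵥ-++⁺ʳ xs (proj₂ (e∈halves b)))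
  e<1+e : ∀ a → a < k → lookup (xs ++ᵥ ys) (i a) < lookup (xs ++ᵥ ys) (j a)
  e<1+e a _ = subst₂ _<_ (sym (π[i] a)) (sym (π[j] a)) (n<1+n (e a))
  1+e<e′ : ∀ a → suc a < k → lookup (xs ++ᵥ ys) (j a) < lookup (xs ++ᵥ ys) (i (suc a))
  1+e<e′ a 1+a<k = subst₂ _<_ (sym (trans (π[j] a) (cong suc (e≡nth (<-trans (n<1+n a) 1+a<k)))))
                              (sym (trans (π[i] (suc a)) (e≡nth 1+a<k)))
                              (AllPairs-nth-suc gaps (<-trans 1+a<k k<|g|))
  ends : 0 < k → (1 ≤ lookup (xs ++ᵥ ys) (i 0)) × (lookup (xs ++ᵥ ys) (j (k ∸ 1)) < h + h)
  ends (s≤s {n = k-1} z≤n) = subst (1 ≤_) (sym (π[i] 0)) (proj₁ (range (∈ᵥ-++⁺ˡ (proj₁ (e∈halves 0)))))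
                           , subst (_< h + h) (sym (trans (π[j] k-1) (cong suc (e≡nth ≤-refl))))
                               (<-≤-trans (AllPairs-nth-suc gaps k<|g|) last≤)
    where
    last≤ : nth g k ≤ h + h
    last≤ = proj₂ (range (∈ᵥ-++⁺ˡ (proj₁ (All-nth halves k<|g|))))

-- Permutations with few good pairs

open Arrangements _≟_

module _ {n} {π : Vec ℕ n} (perm : IsPerm π) where

  perm-range : ∀ {x} → x ∈ᵥ π → 1 ≤ x × x ≤ n
  perm-range x∈π with ∈-map⁻ suc (Any-resp-↭ perm (∈-toList⁺ x∈π))
  ... | _ , z∈ , refl = s≤s z≤n , ∈-upTo⁻ z∈

  perm-∋ : ∀ {x} → 1 ≤ x → x ≤ n → x ∈ᵥ π
  perm-∋ (s≤s z≤n) x≤n = ∈-toList⁻ (Any-resp-↭ (↭-sym perm) (∈-map⁺ suc (∈-upTo⁺ x≤n)))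

  perm-unique : Unique (toList π)
  perm-unique = Unique-resp-↭ (↭⇒↭ₛ (↭-sym perm)) (Unique.map⁺ suc-injective (upTo⁺ n))

firstHalfWord : ∀ {h} → Vec ℕ h → List Bool
firstHalfWord {h} xs = indicator (_∈? xs) 1 (h + h)

splitArrangements : (h : ℕ) → List Bool → List (Vec ℕ (h + h))
splitArrangements h bs =
  cartesianProductWith _++ᵥ_ (arrangements (select 1 bs) h) (arrangements (select 1 (map not bs)) h)

candidates : (h k : ℕ) → List (Vec ℕ (h + h))
candidates h k = concatMap (splitArrangements h) (sparseWords h k)

module _ {h} (xs ys : Vec ℕ h) (perm : IsPerm (xs ++ᵥ ys)) where

  private
    word : List Bool
    word = firstHalfWord xs

    ∈-select-complement : ∀ {x} → x ∉ᵥ xs → 1 ≤ x → x ≤ h + h → x ∈ select 1 (map not word)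
    ∈-select-complement x∉ 1≤x x≤ = subst (λ bs → _ ∈ select 1 bs) (sym (map-not-indicator (_∈? xs) 1 (h + h)))
                                      (∈-select-indicator⁺ (¬? ∘ (_∈? xs)) x∉ 1≤x (s≤s x≤))

  good-values-in-halves : ∀ {e} → GoodValue 1 word e → e ∈ᵥ xs × suc e ∈ᵥ ys
  good-values-in-halves {e} (e∈ , 1+e∈) = proj₁ (∈-select-indicator⁻ (_∈? xs) {e} {1} {h + h} e∈) , 1+e∈ys
    where
    1+e∉xs×1+e< : suc e ∉ᵥ xs × suc e < 1 + (h + h)
    1+e∉xs×1+e< = ∈-select-indicator⁻ (¬? ∘ (_∈? xs)) {suc e} {1} {h + h}
                    (subst (λ bs → suc e ∈ select 1 bs) (map-not-indicator (_∈? xs) 1 (h + h)) 1+e∈)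
    1+e∈ys : suc e ∈ᵥ ys
    1+e∈ys = [ (λ 1+e∈xs → contradiction 1+e∈xs (proj₁ 1+e∉xs×1+e<)) , id ]′
               (Anyᵥ.++⁻ xs (perm-∋ perm (s≤s z≤n) (≤-pred (proj₂ 1+e∉xs×1+e<))))

  many-good-values⇒Type1 : ∀ {k} → k < length (goodValues 1 word) → Type1 (xs ++ᵥ ys) k
  many-good-values⇒Type1 = type1-from-chain xs ys (goodValues 1 word) (perm-range perm)
    (All.map good-values-in-halves (goodValues-good 1 word)) (goodValues-gaps 1 word)

  ∈-candidates : ∀ {k} → ¬ Type1 (xs ++ᵥ ys) k → xs ++ᵥ ys ∈ candidates h k
  ∈-candidates {k} ¬type1 = ∈-concatMap⁺′ (splitArrangements h) word∈ (∈-cartesianProductWith⁺ _++ᵥ_ xs∈ ys∈)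
    where
    word∈ : word ∈ sparseWords h k
    word∈ = ∈-sparseWords h k 1 word (length-indicator (_∈? xs) 1 (h + h))
                          (≮⇒≥ (¬type1 ∘ many-good-values⇒Type1))
    halves : Unique (toList xs) × Unique (toList ys) × (∀ {y} → y ∈ toList ys → y ∉ toList xs)
    halves = Unique-++⁻ (toList xs) (subst Unique (toList-++ xs ys) (perm-unique perm))
    xs∈ : xs ∈ arrangements (select 1 word) h
    xs∈ = ∈-arrangements (select 1 word) xs (proj₁ halves) (All.tabulate λ x∈ →
      let x∈xs = ∈-toList⁻ x∈ ; 1≤x , x≤ = perm-range perm (∈ᵥ-++⁺ˡ x∈xs) in
      ∈-select-indicator⁺ (_∈? xs) x∈xs 1≤x (s≤s x≤))
    ys∈ : ys ∈ arrangements (select 1 (map not word)) h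
    ys∈ = ∈-arrangements (select 1 (map not word)) ys (proj₁ (proj₂ halves)) (All.tabulate λ y∈ →
      let 1≤y , y≤ = perm-range perm (∈ᵥ-++⁺ʳ xs (∈-toList⁻ y∈)) in
      ∈-select-complement (proj₂ (proj₂ halves) y∈ ∘ ∈-toList⁺) 1≤y y≤)

length-candidates : ∀ h k → length (candidates h k) ≤ length (sparseWords h k) * (h ! * h !)
length-candidates h k = length-concatMap-≤ (splitArrangements h) (sparseWords h k) λ {bs} bs∈ → begin
    length (splitArrangements h bs)
  ≡⟨ length-cartesianProductWith _++ᵥ_ (arrangements (select 1 bs) h) (arrangements (select 1 (map not bs)) h) ⟩
    length (arrangements (select 1 bs) h) * length (arrangements (select 1 (map not bs)) h)
  ≤⟨ length-arrangements-pair (select 1 bs) (select 1 (map not bs)) h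
       (trans (length-select-complement 1 bs) (All.lookup (sparseWords-length h k) bs∈)) ⟩
    h ! * h !
  ∎
  where open ≤-Reasoning

non-Type1∈candidates : ∀ h k (π : Vec ℕ (h + h)) → IsPerm π → ¬ Type1 π k → π ∈ candidates h k
non-Type1∈candidates h k π perm ¬type1 with splitAt h π
... | xs , ys , refl = ∈-candidates xs ys perm ¬type1

-- Numerical estimates

^-distribʳ-* : ∀ m n o → (m * n) ^ o ≡ m ^ o * n ^ o
^-distribʳ-* m n zero    = refl
^-distribʳ-* m n (suc o) = trans (cong (m * n *_) (^-distribʳ-* m n o)) (swap-middle m n (m ^ o) (n ^ o))
  where
  swap-middle : ∀ a b c d → a * b * (c * d) ≡ a * c * (b * d)
  swap-middle = solve-∀

central-binomial-bound : ∀ h → 4 ^ h * (h ! * h !) ≤ suc (h + h) * (h + h) !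
central-binomial-bound zero    = ≤-refl
central-binomial-bound (suc h) = begin
    4 ^ suc h * (suc h ! * suc h !)
  ≡⟨ square-out (4 ^ h) (h !) h ⟩
    (2 + (h + h)) * (2 + (h + h)) * (4 ^ h * (h ! * h !))
  ≤⟨ *-monoʳ-≤ ((2 + (h + h)) * (2 + (h + h))) (central-binomial-bound h) ⟩
    (2 + (h + h)) * (2 + (h + h)) * (suc (h + h) * (h + h) !)
  ≤⟨ *-monoˡ-≤ (suc (h + h) * (h + h) !) (*-monoˡ-≤ (2 + (h + h)) (n≤1+n (2 + (h + h)))) ⟩
    (3 + (h + h)) * (2 + (h + h)) * (suc (h + h) * (h + h) !)
  ≡⟨ *-assoc (3 + (h + h)) (2 + (h + h)) (suc (h + h) * (h + h) !) ⟩
    suc (2 + (h + h)) * (2 + (h + h)) !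
  ≡⟨ cong (λ m → suc m * m !) (sym (+-suc (suc h) h)) ⟩
    suc (suc h + suc h) * (suc h + suc h) !
  ∎
  where
  open ≤-Reasoning
  square-out : ∀ x f h → 4 * x * ((suc h * f) * (suc h * f)) ≡ (2 + (h + h)) * (2 + (h + h)) * (x * (f * f))
  square-out = solve-∀

linear≤exponential : ∀ {k} → 9 ≤ k → suc (32 * k) ≤ 2 ^ k
linear≤exponential {k} 9≤k = subst (λ m → suc (32 * m) ≤ 2 ^ m) (m+[n∸m]≡n 9≤k) (from-nine (k ∸ 9))
  where
  open ≤-Reasoning
  from-nine : ∀ d → suc (32 * (9 + d)) ≤ 2 ^ (9 + d)
  from-nine zero    = ≤ᵇ⇒≤ 289 512 _
  from-nine (suc d) = begin
      suc (32 * (9 + suc d))     ≡⟨ unfold d ⟩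
      32 + suc (32 * (9 + d))    ≤⟨ +-mono-≤ (≤-trans (≤ᵇ⇒≤ 32 512 _) (^-monoʳ-≤ 2 (m≤m+n 9 d))) (from-nine d) ⟩
      2 ^ (9 + d) + 2 ^ (9 + d)  ≡⟨ cong (2 ^ (9 + d) +_) (sym (+-identityʳ _)) ⟩
      2 ^ (9 + suc d)            ∎
    where
    unfold : ∀ d → suc (32 * (9 + suc d)) ≡ 32 + suc (32 * (9 + d))
    unfold = solve-∀

thirteen-vs-sixteen : ∀ k → 13 ^ (16 * k) * 16 ^ k ≤ 16 ^ (16 * k)
thirteen-vs-sixteen k = begin
    13 ^ (16 * k) * 16 ^ k  ≡⟨ cong (_* 16 ^ k) (sym (^-*-assoc 13 16 k)) ⟩
    (13 ^ 16) ^ k * 16 ^ k  ≡⟨ sym (^-distribʳ-* (13 ^ 16) 16 k) ⟩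
    (13 ^ 16 * 16) ^ k      ≤⟨ ^-monoˡ-≤ k (≤ᵇ⇒≤ (13 ^ 16 * 16) (16 ^ 16) _) ⟩
    (16 ^ 16) ^ k           ≡⟨ ^-*-assoc 16 16 k ⟩
    16 ^ (16 * k)           ∎
  where open ≤-Reasoning

scaled-count-bound : ∀ {k N S} → let h = 16 * k in
  9 ≤ k → N ≤ S * (h ! * h !) → S * 4 ^ h ≤ 13 ^ h * 4 ^ k → N * 2 ^ k ≤ (h + h) !
scaled-count-bound {k} {N} {S} 9≤k N≤ S≤ = *-cancelʳ-≤ (N * 2 ^ k) ((h + h) !) (16 ^ h) {{m^n≢0 16 h}} (begin
    N * 2 ^ k * 16 ^ h
  ≤⟨ *-monoˡ-≤ (16 ^ h) (*-monoˡ-≤ (2 ^ k) N≤) ⟩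
    S * f * 2 ^ k * 16 ^ h
  ≡⟨ cong (S * f * 2 ^ k *_) (^-distribʳ-* 4 4 h) ⟩
    S * f * 2 ^ k * (4 ^ h * 4 ^ h)
  ≡⟨ regroup₁ S f (2 ^ k) (4 ^ h) ⟩
    (S * 4 ^ h) * (4 ^ h * f) * 2 ^ k
  ≤⟨ *-monoˡ-≤ (2 ^ k) (*-mono-≤ S≤ (central-binomial-bound h)) ⟩
    13 ^ h * 4 ^ k * (suc (h + h) * (h + h) !) * 2 ^ k
  ≤⟨ *-monoˡ-≤ (2 ^ k) (*-monoʳ-≤ (13 ^ h * 4 ^ k) (*-monoˡ-≤ ((h + h) !) 2h+1≤2^k)) ⟩
    13 ^ h * 4 ^ k * (2 ^ k * (h + h) !) * 2 ^ k
  ≡⟨ regroup₂ (13 ^ h) (4 ^ k) (2 ^ k) ((h + h) !) ⟩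
    13 ^ h * (4 ^ k * 2 ^ k * 2 ^ k) * (h + h) !
  ≡⟨ cong (λ x → 13 ^ h * x * (h + h) !) (powers-of-sixteen k) ⟩
    13 ^ h * 16 ^ k * (h + h) !
  ≤⟨ *-monoˡ-≤ ((h + h) !) (thirteen-vs-sixteen k) ⟩
    16 ^ h * (h + h) !
  ≡⟨ *-comm (16 ^ h) ((h + h) !) ⟩
    (h + h) ! * 16 ^ h
  ∎)
  where
  open ≤-Reasoning
  h f : ℕ
  h = 16 * k
  f = h ! * h !
  2h+1≤2^k : suc (h + h) ≤ 2 ^ k
  2h+1≤2^k = subst (λ m → suc m ≤ 2 ^ k) (double-16 k) (linear≤exponential 9≤k)
    where
    double-16 : ∀ k → 32 * k ≡ 16 * k + 16 * k
    double-16 = solve-∀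
  powers-of-sixteen : ∀ k → 4 ^ k * 2 ^ k * 2 ^ k ≡ 16 ^ k
  powers-of-sixteen zero    = refl
  powers-of-sixteen (suc k) = trans (step (4 ^ k) (2 ^ k)) (cong (16 *_) (powers-of-sixteen k))
    where
    step : ∀ a b → 4 * a * (2 * b) * (2 * b) ≡ 16 * (a * b * b)
    step = solve-∀
  regroup₁ : ∀ s f t x → s * f * t * (x * x) ≡ (s * x) * (x * f) * t
  regroup₁ = solve-∀
  regroup₂ : ∀ a b t g → a * b * (t * g) * t ≡ a * (b * t * t) * g
  regroup₂ = solve-∀

exponential-saving : ∀ {N M} k q → N * 2 ^ k ≤ M → N ^ q * 2 ^ (1 * (k * q)) ≤ M ^ q
exponential-saving {N} {M} k q N2^k≤M = begin
  N ^ q * 2 ^ (1 * (k * q)) ≡⟨ cong (λ e → N ^ q * 2 ^ e) (*-identityˡ (k * q)) ⟩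
  N ^ q * 2 ^ (k * q)       ≡⟨ cong (N ^ q *_) (^-*-assoc 2 k q) ⟨
  N ^ q * (2 ^ k) ^ q       ≡⟨ ^-distribʳ-* N (2 ^ k) q ⟨
  (N * 2 ^ k) ^ q           ≤⟨ ^-monoˡ-≤ q N2^k≤M ⟩
  M ^ q                     ∎
  where open ≤-Reasoning

NonType1Cover : ℕ → ℕ → Set
NonType1Cover n k =
  Σ (List (Vec ℕ n)) λ L → (∀ π → IsPerm π → ¬ Type1 π k → π ∈ L) × (length L * 2 ^ k ≤ n !)

nonType1-cover : ∀ {k} → 9 ≤ k → NonType1Cover (k * 32) k
nonType1-cover {k} 9≤k = subst (λ n → NonType1Cover n k) (h+h≡k*32 k)
  ( candidates h k , non-Type1∈candidates h k
  , scaled-count-bound {S = length (sparseWords h k)} 9≤k (length-candidates h k) (length-sparseWords h k))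
  where
  h : ℕ
  h = 16 * k
  h+h≡k*32 : ∀ k → 16 * k + 16 * k ≡ k * 32
  h+h≡k*32 = solve-∀

claim3 : Σ ℕ λ p → Σ ℕ λ q → (0 < p) × (0 < q) × (Σ ℕ λ N →
           ∀ n → 32 ∣ n → N ≤ n →
             Σ (List (Vec ℕ n)) λ L →
                 (∀ (π : Vec ℕ n) → IsPerm π → ¬ Type1 π (n / 32) → π ∈ L)
               × (length L ^ q * 2 ^ (p * n) ≤ (n !) ^ q))
claim3 = 1 , 32 , z<s , z<s , 288 , λ where
  .(k * 32) (divides k refl) 288≤n →
    let L , covers , bound = nonType1-cover (*-cancelʳ-≤ 9 k 32 288≤n) in
    L , (λ π perm → covers π perm ∘ subst (¬_ ∘ Type1 π) (m*n/n≡m k 32))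
      , exponential-saving {N = length L} k 32 bound
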